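{- Let $1<n\le m$ and let $v$ be a vertex of $Z_{n,m}$ with $\sum_{i\in I_c(v)}v_i=n$. Then $d(v,0)\le\sum_{i=1}^{p_l(v)}i+\sum_{i=1}^{m-p_r(v)}i+\lfloor\frac{n(m+1)}{2}\rfloor$.
   Context: Elements of $\mathbb{Z}_n$ are identified with their smallest nonnegative representatives in $\{0,\dots,n-1\}$ (so $v_0,v_{m+1}$ are integers in $[0,n-1]$ in sums). The dYoke graph $Z_{n,m}$ has as vertices all tuples $u=(u_0,\dots,u_{m+1})$ with $u_0,u_{m+1}\in\mathbb{Z}_n$, $u_1,\dots,u_m\in\{ -1,0,1\}$ and $\sum_{i=0}^{m+1}u_i\equiv0\pmod n$; adjacency: there is $0\le i\le m$ with $u_j=v_j$ for $j\notin\{i,i+1\}$ and either ($u_i=v_i+1$, $u_{i+1}=v_{i+1}-1$) or ($u_i=v_i-1$, $u_{i+1}=v_{i+1}+1$), arithmetic in coordinates $0,m+1$ in $\mathbb{Z}_n$. $0$ is the all-zero vertex, $d$ is graph distance. A pivot of $v$ is an integer $-1\le p\le m+1$ such that $n\mid\sum_{i=0}^{p}v_i$ (empty sum $=0$); $\operatorname{Piv}(v)$ is the set of pivots. $p_l(v)=\max\{p\in\operatorname{Piv}(v):p<\frac m2\}$, $p_r(v)=\min\{p\in\operatorname{Piv}(v):p\ge\frac m2\}$, $I_c(v)=[p_l(v)+1,p_r(v)]$ (integer interval). -}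

module Defs where

open import Data.Bool using (if_then_else_)
open import Data.Nat as ℕ using (ℕ; zero; suc)
open import Data.Integer as ℤ using (ℤ; +_; -[1+_]; 0ℤ; 1ℤ; -1ℤ)
open import Data.Integer.Divisibility using (_∣_)
open import Data.Product using (Σ; _×_; ∃; ∃-syntax)
open import Data.Sum using (_⊎_)
open import Relation.Nullary using (¬_)
open import Relation.Binary.PropositionalEquality using (_≡_; _≢_)

-- A (candidate) tuple u = (u_0,…,u_{m+1}) is represented as a function
-- ℕ → ℤ; only the coordinates 0 … m+1 are ever inspected.
-- Coordinates 0 and m+1 (elements of ℤ_n) are stored as their
-- representatives in {0,…,n-1} (enforced by IsVertex).
Tuple : Set
Tuple = ℕ → ℤ

-- psum u k = u_0 + … + u_{k-1}   (so  Σ_{i=0}^{p} u_i = psum u (p+1))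
psum : Tuple → ℕ → ℤ
psum u zero    = 0ℤ
psum u (suc k) = psum u k ℤ.+ u k

sumBelow : Tuple → ℕ → ℕ → ℤ
sumBelow u a zero    = 0ℤ
sumBelow u a (suc k) = sumBelow u a k ℤ.+ (if a ℕ.≤ᵇ k then u k else 0ℤ)

sumFromTo : Tuple → ℕ → ℕ → ℤ
sumFromTo u a b = sumBelow u a (suc b)

tri : ℕ → ℕ
tri zero    = zero
tri (suc k) = suc k ℕ.+ tri k

triZ : ℤ → ℕ
triZ (+ k)    = tri k
triZ -[1+ _ ] = zero

record IsVertex (n m : ℕ) (u : Tuple) : Set where
  field
    first-range : + 0 ℤ.≤ u 0 × u 0 ℤ.< + n
    last-range  : + 0 ℤ.≤ u (suc m) × u (suc m) ℤ.< + n
    middle      : ∀ j → 1 ℕ.≤ j → j ℕ.≤ m → u j ≡ -1ℤ ⊎ u j ≡ 0ℤ ⊎ u j ≡ 1ℤ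
    sum-zero    : + n ∣ psum u (suc (suc m))

-- coordinates 0 and m+1 carry ℤ_n arithmetic
Boundary : ℕ → ℕ → Set
Boundary m j = j ≡ 0 ⊎ j ≡ suc m

CoordEq : ℕ → ℕ → ℕ → ℤ → ℤ → Set
CoordEq n m j x y = (Boundary m j → + n ∣ (x ℤ.- y)) × (¬ Boundary m j → x ≡ y)

Adj : ℕ → ℕ → Tuple → Tuple → Set
Adj n m u v =
  Σ ℕ λ i → i ℕ.≤ m × Σ ℤ λ s → (s ≡ 1ℤ ⊎ s ≡ -1ℤ) ×
    ((∀ j → j ℕ.≤ suc m → j ≢ i → j ≢ suc i → CoordEq n m j (u j) (v j)) ×
     CoordEq n m i (u i) (v i ℤ.+ s) ×
     CoordEq n m (suc i) (u (suc i)) (v (suc i) ℤ.- s))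

SameVertex : ℕ → ℕ → Tuple → Tuple → Set
SameVertex n m u w = ∀ j → j ℕ.≤ suc m → CoordEq n m j (u j) (w j)

data Walk (n m : ℕ) : Tuple → Tuple → ℕ → Set where
  here : ∀ {u w} → SameVertex n m u w → Walk n m u w 0
  step : ∀ {u x w k} → Adj n m u x → IsVertex n m x → Walk n m x w k →
         Walk n m u w (suc k)

zeroV : Tuple
zeroV _ = 0ℤ

DistLe : ℕ → ℕ → Tuple → Tuple → ℕ → Set
DistLe n m u w B = ∃[ k ] (k ℕ.≤ B × Walk n m u w k)

IsPivot : ℕ → ℕ → Tuple → ℤ → Set
IsPivot n m v p =
  -1ℤ ℤ.≤ p × p ℤ.≤ + suc m × + n ∣ psum v ℤ.∣ p ℤ.+ 1ℤ ∣

IsPl : ℕ → ℕ → Tuple → ℤ → Set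
IsPl n m v p =
  (IsPivot n m v p × + 2 ℤ.* p ℤ.< + m) ×
  (∀ q → IsPivot n m v q → + 2 ℤ.* q ℤ.< + m → q ℤ.≤ p)

IsPr : ℕ → ℕ → Tuple → ℤ → Set
IsPr n m v p =
  (IsPivot n m v p × + m ℤ.≤ + 2 ℤ.* p) ×
  (∀ q → IsPivot n m v q → + m ℤ.≤ + 2 ℤ.* q → p ℤ.≤ q)

-- Write h k = v_0 + … + v_{k-1} for the prefix sums of v.  For every multiple
-- c of n, v is the slope sequence of the height function k ↦ h k - c, and
-- pushing a value of maximal modulus one unit towards 0 is an edge of
-- Z_{n,m}; hence d(v, 0) ≤ Σ_{k=1}^{m+1} |h k - c|   (module Heights).
-- With P = p_l + 1, Q = p_r + 1 and a = h P we have h Q = a + n, and no h k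
-- with P < k < Q is a multiple of n, since it would be a pivot contradicting
-- the choice of p_l or p_r.  So g = h - a stays strictly between 0 and n
-- inside (P, Q) and moves by at most one per step outside [P, Q], giving
--   |g k| + |g k - n| ≤ n + 2 ((P - k)⁺ + (k - Q)⁺)   (module WindowBound).
-- Summing over k, the two walks for c = a and c = a + n have total length at
-- most n (m + 1) + 2 (T(P - 1) + T(m + 1 - Q)), and the shorter one proves the
-- bound.

module Submission where

open import Defs
open import Data.Nat using (ℕ; _+_; _*_; _/_; _<_; _≤_; _∸_)
open import Data.Integer as ℤ using (ℤ; +_)
open import Relation.Binary.PropositionalEquality using (_≡_)

open import Data.Bool using (true; false; T)
open import Data.Empty using (⊥; ⊥-elim)
open import Data.Integer as ℤ using (-[1+_]; 0ℤ; 1ℤ; -1ℤ)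
open import Data.Integer.Divisibility using (_∣_)
import Data.Integer.Divisibility.Signed as S
open import Data.Integer.DivMod using (_%ℕ_; _/ℕ_; n%ℕd<d; a≡a%ℕn+[a/ℕn]*n)
import Data.Integer.Properties as ℤP
open import Data.Integer.Tactic.RingSolver using (solve-∀)
open import Data.Nat as ℕ using (zero; suc; z≤n; s≤s; NonZero)
open import Data.Nat.Divisibility using (divides-refl)
import Data.Nat.DivMod as ℕDM
import Data.Nat.Properties as ℕP
import Data.Nat.Tactic.RingSolver as ℕSolver
open import Data.Product using (Σ; _×_; _,_; proj₁; proj₂)
open import Data.Sum using (_⊎_; inj₁; inj₂) renaming (map to map-⊎)
open import Data.Unit using (tt)
open import Function using (_∘_; case_of_)
open import Relation.Nullary using (¬_; Dec; yes; no)
open import Relation.Binary.PropositionalEquality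
  using (_≢_; refl; sym; trans; cong; cong₂; subst; module ≡-Reasoning)

-- sumTo f N = f 0 + … + f (N-1), built from the front so that the shift
-- j ↦ suc j is structural.
sumTo : (ℕ → ℕ) → ℕ → ℕ
sumTo f zero    = 0
sumTo f (suc N) = f 0 + sumTo (λ j → f (suc j)) N

sumTo-cong : ∀ N {f g} → (∀ j → j < N → f j ≡ g j) → sumTo f N ≡ sumTo g N
sumTo-cong zero    f≡g = refl
sumTo-cong (suc N) f≡g =
  cong₂ _+_ (f≡g 0 (s≤s z≤n)) (sumTo-cong N (λ j j<N → f≡g (suc j) (s≤s j<N)))

sumTo-mono : ∀ N {f g} → (∀ j → j < N → f j ≤ g j) → sumTo f N ≤ sumTo g N
sumTo-mono zero    f≤g = z≤n
sumTo-mono (suc N) f≤g =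
  ℕP.+-mono-≤ (f≤g 0 (s≤s z≤n)) (sumTo-mono N (λ j j<N → f≤g (suc j) (s≤s j<N)))

sumTo-+ : ∀ N f g → sumTo (λ j → f j + g j) N ≡ sumTo f N + sumTo g N
sumTo-+ zero    f g = refl
sumTo-+ (suc N) f g = trans (cong (_+_ (f 0 + g 0)) (sumTo-+ N _ _))
                            (interchange (f 0) (g 0) _ _)
  where
  interchange : ∀ a b c d → (a + b) + (c + d) ≡ (a + c) + (b + d)
  interchange = ℕSolver.solve-∀

sumTo-const : ∀ N c → sumTo (λ _ → c) N ≡ N * c
sumTo-const zero    c = refl
sumTo-const (suc N) c = cong (_+_ c) (sumTo-const N c)

sumTo-snoc : ∀ N f → sumTo f (suc N) ≡ sumTo f N + f N
sumTo-snoc zero    f = ℕP.+-comm (f 0) 0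
sumTo-snoc (suc N) f = trans (cong (_+_ (f 0)) (sumTo-snoc N (λ j → f (suc j))))
                             (sym (ℕP.+-assoc (f 0) _ _))

sumTo-≡0 : ∀ N f → sumTo f N ≡ 0 → ∀ j → j < N → f j ≡ 0
sumTo-≡0 (suc N) f e zero    _         = ℕP.m+n≡0⇒m≡0 (f 0) e
sumTo-≡0 (suc N) f e (suc j) (s≤s j<N) =
  sumTo-≡0 N (λ j → f (suc j)) (ℕP.m+n≡0⇒n≡0 (f 0) e) j j<N

sumTo-lower : ∀ N f f′ k → k < N → (∀ j → j ≢ k → f′ j ≡ f j) → suc (f′ k) ≡ f k →
              suc (sumTo f′ N) ≡ sumTo f N
sumTo-lower (suc N) f f′ zero _ same lowered =
  cong₂ _+_ lowered (sumTo-cong N (λ j _ → same (suc j) (λ ())))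
sumTo-lower (suc N) f f′ (suc k) (s≤s k<N) same lowered =
  trans (sym (ℕP.+-suc (f′ 0) _))
        (cong₂ _+_ (same 0 (λ ()))
                   (sumTo-lower N _ _ k k<N (λ j j≢k → same (suc j) (j≢k ∘ ℕP.suc-injective)) lowered))

bound-snoc : ∀ (f : ℕ → ℕ) N {c} → (∀ j → j < N → f j ≤ c) → f N ≤ c →
             ∀ j → j < suc N → f j ≤ c
bound-snoc f N below atN j j<N+1 with ℕP.m≤n⇒m<n∨m≡n (ℕP.≤-pred j<N+1)
... | inj₁ j<N  = below j j<N
... | inj₂ refl = atN

argmax : ∀ (f : ℕ → ℕ) N → Σ ℕ λ k → k < suc N × (∀ j → j < suc N → f j ≤ f k)
argmax f zero    = 0 , s≤s z≤n , bound-snoc f 0 (λ _ ()) ℕP.≤-refl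
argmax f (suc N) with argmax f N
... | k , k≤N , k-max with f k ℕ.≤? f (suc N)
...   | yes fk≤ = suc N , ℕP.≤-refl ,
                  bound-snoc f (suc N) (λ j j≤N → ℕP.≤-trans (k-max j j≤N) fk≤) ℕP.≤-refl
...   | no  fk≰ = k , ℕP.m≤n⇒m≤1+n k≤N ,
                  bound-snoc f (suc N) k-max (ℕP.<⇒≤ (ℕP.≰⇒> fk≰))

sum-left-tail : ∀ N P → sumTo (λ j → P ∸ suc j) N ≤ tri (P ∸ 1)
sum-left-tail zero    P       = z≤n
sum-left-tail (suc N) zero    = ℕP.≤-reflexive (trans (sumTo-const N 0) (ℕP.*-zeroʳ N))
sum-left-tail (suc N) (suc P) = ℕP.≤-trans (ℕP.+-monoʳ-≤ P (sum-left-tail N P)) (ℕP.≤-reflexive (unfold P))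
  where
  unfold : ∀ P → P + tri (P ∸ 1) ≡ tri P
  unfold zero    = refl
  unfold (suc P) = refl

sum-right-tail : ∀ N Q → sumTo (λ j → suc j ∸ Q) N ≡ tri (N ∸ Q)
sum-right-tail zero    Q = sym (cong tri (ℕP.0∸n≡0 Q))
sum-right-tail (suc N) Q = begin
  sumTo (λ j → suc j ∸ Q) (suc N)          ≡⟨ sumTo-snoc N (λ j → suc j ∸ Q) ⟩
  sumTo (λ j → suc j ∸ Q) N + (suc N ∸ Q)  ≡⟨ cong (_+ (suc N ∸ Q)) (sum-right-tail N Q) ⟩
  tri (N ∸ Q) + (suc N ∸ Q)                ≡⟨ tri-grow N Q ⟩
  tri (suc N ∸ Q)                          ∎
  where
  open ≡-Reasoning
  tri-grow : ∀ N Q → tri (N ∸ Q) + (suc N ∸ Q) ≡ tri (suc N ∸ Q)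
  tri-grow N       zero    = ℕP.+-comm (tri N) (suc N)
  tri-grow zero    (suc Q) rewrite ℕP.0∸n≡0 Q = refl
  tri-grow (suc N) (suc Q) = tri-grow N Q

halve : ∀ A T M → A * 2 ≤ M + T * 2 → A ≤ T + M / 2
halve A T M 2A≤ = begin
  A                  ≡⟨ ℕDM.m*n/n≡m A 2 ⟨
  A * 2 / 2          ≤⟨ ℕDM./-monoˡ-≤ 2 2A≤ ⟩
  (M + T * 2) / 2    ≡⟨ ℕDM.+-distrib-/-∣ʳ M (divides-refl T) ⟩
  M / 2 + T * 2 / 2  ≡⟨ cong (_+_ (M / 2)) (ℕDM.m*n/n≡m T 2) ⟩
  M / 2 + T          ≡⟨ ℕP.+-comm (M / 2) T ⟩
  T + M / 2          ∎
  where open ℕP.≤-Reasoning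

Trit : ℤ → Set
Trit x = x ≡ -1ℤ ⊎ x ≡ 0ℤ ⊎ x ≡ 1ℤ

Sign : ℤ → Set
Sign s = s ≡ 1ℤ ⊎ s ≡ -1ℤ

sign-neg : ∀ {s} → Sign s → Sign (ℤ.- s)
sign-neg (inj₁ refl) = inj₂ refl
sign-neg (inj₂ refl) = inj₁ refl

trit-neg : ∀ {x} → Trit x → Trit (ℤ.- x)
trit-neg (inj₁ refl)        = inj₂ (inj₂ refl)
trit-neg (inj₂ (inj₁ refl)) = inj₂ (inj₁ refl)
trit-neg (inj₂ (inj₂ refl)) = inj₁ refl

∣trit∣≤1 : ∀ {x} → Trit x → ℤ.∣ x ∣ ≤ 1
∣trit∣≤1 (inj₁ refl)        = ℕP.≤-refl
∣trit∣≤1 (inj₂ (inj₁ refl)) = z≤n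
∣trit∣≤1 (inj₂ (inj₂ refl)) = ℕP.≤-refl

trit-+ : ∀ {x s} → Trit x → Sign s → x ≢ s → Trit (x ℤ.+ s)
trit-+ (inj₁ refl)        (inj₁ refl) _   = inj₂ (inj₁ refl)
trit-+ (inj₂ (inj₁ refl)) (inj₁ refl) _   = inj₂ (inj₂ refl)
trit-+ (inj₂ (inj₂ refl)) (inj₁ refl) x≢s = ⊥-elim (x≢s refl)
trit-+ (inj₁ refl)        (inj₂ refl) x≢s = ⊥-elim (x≢s refl)
trit-+ (inj₂ (inj₁ refl)) (inj₂ refl) _   = inj₁ refl
trit-+ (inj₂ (inj₂ refl)) (inj₂ refl) _   = inj₂ (inj₁ refl)

large-not-trit : ∀ {k} → 1 < k → ¬ Trit (+ k)
large-not-trit (s≤s (s≤s _)) (inj₁ ())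
large-not-trit (s≤s (s≤s _)) (inj₂ (inj₁ ()))
large-not-trit (s≤s (s≤s _)) (inj₂ (inj₂ ()))

trit-- : ∀ {x s} → Trit x → Sign s → x ≢ ℤ.- s → Trit (x ℤ.- s)
trit-- x s = trit-+ x (sign-neg s)

step-toward-zero : ∀ x → x ≢ 0ℤ →
  Σ ℤ λ s → Sign s × suc ℤ.∣ x ℤ.- s ∣ ≡ ℤ.∣ x ∣ × ℤ.∣ x ℤ.+ s ∣ ≡ suc ℤ.∣ x ∣
step-toward-zero (+ zero)       x≢0 = ⊥-elim (x≢0 refl)
step-toward-zero (+ suc a)      _   = 1ℤ , inj₁ refl , refl , ℕP.+-comm (suc a) 1
step-toward-zero -[1+ zero ]    _   = -1ℤ , inj₂ refl , refl , refl
step-toward-zero -[1+ suc a ]   _   = -1ℤ , inj₂ refl , refl , cong (suc ∘ suc ∘ suc) (ℕP.+-identityʳ a)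

≡+⇒≡- : ∀ {a b s : ℤ} → a ≡ b ℤ.+ s → b ≡ a ℤ.- s
≡+⇒≡- {b = b} {s} refl = sym (cancel b s)
  where
  cancel : ∀ b s → b ℤ.+ s ℤ.- s ≡ b
  cancel = solve-∀

diff≡⇒≡+ : ∀ {a b s : ℤ} → a ℤ.- b ≡ s → a ≡ b ℤ.+ s
diff≡⇒≡+ {a} {b} refl = sym (cancel a b)
  where
  cancel : ∀ a b → b ℤ.+ (a ℤ.- b) ≡ a
  cancel = solve-∀

diff≡-⇒≡+ : ∀ {a b s : ℤ} → a ℤ.- b ≡ ℤ.- s → b ≡ a ℤ.+ s
diff≡-⇒≡+ {a} {b} {s} a-b≡-s =
  trans (cancel a b) (trans (cong (λ t → a ℤ.- t) a-b≡-s) (cong (ℤ._+_ a) (ℤP.neg-involutive s)))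
  where
  cancel : ∀ a b → b ≡ a ℤ.- (a ℤ.- b)
  cancel = solve-∀

update : Tuple → ℕ → ℤ → Tuple
update d k x j with j ℕ.≟ k
... | yes _ = x
... | no  _ = d j

update-same : ∀ d k x → update d k x k ≡ x
update-same d k x with k ℕ.≟ k
... | yes _   = refl
... | no  k≢k = ⊥-elim (k≢k refl)

update-other : ∀ d k x j → j ≢ k → update d k x j ≡ d j
update-other d k x j j≢k with j ℕ.≟ k
... | yes j≡k = ⊥-elim (j≢k j≡k)
... | no  _   = refl

-- A sequence d with d 0 ≡ d (m+2) ≡ 0 (mod n) that moves
-- by at most one across each middle coordinate has as "slope sequence"
-- (d (j+1) - d j)_j, with boundary slopes reduced mod n, a vertex of Z_{n,m}.
-- Pushing one extremal value of d one unit towards 0 is an edge of Z_{n,m},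
-- so the slope sequence is at distance at most Σ_{k=1}^{m+1} |d k| from 0.
module Heights (n m : ℕ) .{{_ : NonZero n}} where

  boundary? : ∀ j → Dec (Boundary m j)
  boundary? j with j ℕ.≟ 0 | j ℕ.≟ suc m
  ... | yes j≡0 | _         = yes (inj₁ j≡0)
  ... | no  _   | yes j≡m+1 = yes (inj₂ j≡m+1)
  ... | no  j≢0 | no  j≢m+1 = no λ { (inj₁ j≡0) → j≢0 j≡0 ; (inj₂ j≡m+1) → j≢m+1 j≡m+1 }

  interior-not-boundary : ∀ {j} → 1 ≤ j → j ≤ m → ¬ Boundary m j
  interior-not-boundary (s≤s _) _   (inj₁ ())
  interior-not-boundary _       j≤m (inj₂ refl) = ℕP.1+n≰n j≤m

  coord-from-div : ∀ {j x y} → + n S.∣ (x ℤ.- y) → (¬ Boundary m j → x ≡ y) → CoordEq n m j x y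
  coord-from-div n∣x-y interior = (λ _ → S.∣⇒∣ᵤ n∣x-y) , interior

  coord-≡ : ∀ {j x y} → x ≡ y → CoordEq n m j x y
  coord-≡ {x = x} refl = coord-from-div (S.divides 0ℤ (ℤP.+-inverseʳ x)) (λ _ → refl)

  coord-sym : ∀ {j x y} → CoordEq n m j x y → CoordEq n m j y x
  coord-sym {x = x} {y} (atBoundary , inside) =
    (λ b → S.∣⇒∣ᵤ (subst (+ n S.∣_) (negate x y) (S.∣m⇒∣-m (S.∣ᵤ⇒∣ (atBoundary b))))) ,
    (λ nb → sym (inside nb))
    where
    negate : ∀ x y → ℤ.- (x ℤ.- y) ≡ y ℤ.- x
    negate = solve-∀

  coord-trans : ∀ {j x y z} → CoordEq n m j x y → CoordEq n m j y z → CoordEq n m j x z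
  coord-trans {x = x} {y} {z} (atBoundary₁ , inside₁) (atBoundary₂ , inside₂) =
    (λ b → S.∣⇒∣ᵤ (subst (+ n S.∣_) (telescope x y z)
                   (S.∣m∣n⇒∣m+n (S.∣ᵤ⇒∣ {i = x ℤ.- y} (atBoundary₁ b)) (S.∣ᵤ⇒∣ {i = y ℤ.- z} (atBoundary₂ b))))) ,
    (λ nb → trans (inside₁ nb) (inside₂ nb))
    where
    telescope : ∀ x y z → (x ℤ.- y) ℤ.+ (y ℤ.- z) ≡ x ℤ.- z
    telescope = solve-∀

  coord-+ : ∀ {j x y} s → CoordEq n m j x y → CoordEq n m j (x ℤ.+ s) (y ℤ.+ s)
  coord-+ {x = x} {y} s (atBoundary , inside) =
    (λ b → subst (+ n ∣_) (sym (cancel x y s)) (atBoundary b)) , (λ nb → cong (ℤ._+ s) (inside nb))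
    where
    cancel : ∀ x y s → (x ℤ.+ s) ℤ.- (y ℤ.+ s) ≡ x ℤ.- y
    cancel = solve-∀

  reduce : ℕ → ℤ → ℤ
  reduce j x with boundary? j
  ... | yes _ = + (x %ℕ n)
  ... | no  _ = x

  reduce-div : ∀ j x → + n S.∣ (reduce j x ℤ.- x)
  reduce-div j x with boundary? j
  ... | no  _ = S.divides 0ℤ (ℤP.+-inverseʳ x)
  ... | yes _ = S.divides (ℤ.- (x /ℕ n)) (begin
    + (x %ℕ n) ℤ.- x                                 ≡⟨ cong (λ t → + (x %ℕ n) ℤ.- t) (a≡a%ℕn+[a/ℕn]*n x n) ⟩
    + (x %ℕ n) ℤ.- (+ (x %ℕ n) ℤ.+ (x /ℕ n) ℤ.* + n) ≡⟨ cancel (+ (x %ℕ n)) (x /ℕ n) (+ n) ⟩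
    ℤ.- (x /ℕ n) ℤ.* + n                             ∎)
    where
    open ≡-Reasoning
    cancel : ∀ r q k → r ℤ.- (r ℤ.+ q ℤ.* k) ≡ ℤ.- q ℤ.* k
    cancel = solve-∀

  reduce-interior : ∀ j x → ¬ Boundary m j → reduce j x ≡ x
  reduce-interior j x nb with boundary? j
  ... | yes b = ⊥-elim (nb b)
  ... | no  _ = refl

  reduce-coord : ∀ j x → CoordEq n m j (reduce j x) x
  reduce-coord j x = coord-from-div (reduce-div j x) (reduce-interior j x)

  reduce-range : ∀ j x → Boundary m j → + 0 ℤ.≤ reduce j x × reduce j x ℤ.< + n
  reduce-range j x b with boundary? j
  ... | yes _ = ℤ.+≤+ z≤n , ℤ.+<+ (n%ℕd<d x n)
  ... | no nb = ⊥-elim (nb b)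

  slope : Tuple → ℕ → ℤ
  slope d j = d (suc j) ℤ.- d j

  slopes : Tuple → Tuple
  slopes d j = reduce j (slope d j)

  record IsHeight (d : Tuple) : Set where
    field
      start     : + n S.∣ d 0
      end       : + n S.∣ d (suc (suc m))
      lipschitz : ∀ j → 1 ≤ j → j ≤ m → Trit (slope d j)

  psum-slopes : ∀ d K → + n S.∣ (psum (slopes d) K ℤ.- (d K ℤ.- d 0))
  psum-slopes d zero    = S.divides 0ℤ (cancel (d 0))
    where
    cancel : ∀ a → 0ℤ ℤ.- (a ℤ.- a) ≡ 0ℤ
    cancel = solve-∀
  psum-slopes d (suc K) =
    subst (+ n S.∣_) (regroup (psum (slopes d) K) (slopes d K) (d K) (d (suc K)) (d 0))
          (S.∣m∣n⇒∣m+n (psum-slopes d K) (reduce-div K (slope d K)))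
    where
    regroup : ∀ p t a b z → (p ℤ.- (a ℤ.- z)) ℤ.+ (t ℤ.- (b ℤ.- a)) ≡ (p ℤ.+ t) ℤ.- (b ℤ.- z)
    regroup = solve-∀

  slopes-vertex : ∀ d → IsHeight d → IsVertex n m (slopes d)
  slopes-vertex d h = record
    { first-range = reduce-range 0 (slope d 0) (inj₁ refl)
    ; last-range  = reduce-range (suc m) (slope d (suc m)) (inj₂ refl)
    ; middle      = λ j 1≤j j≤m → subst Trit (sym (reduce-interior j _ (interior-not-boundary 1≤j j≤m)))
                                            (lipschitz j 1≤j j≤m)
    ; sum-zero    = S.∣⇒∣ᵤ (subst (+ n S.∣_) (cancel (psum (slopes d) (suc (suc m))) (d (suc (suc m)) ℤ.- d 0))
                             (S.∣m∣n⇒∣m+n (psum-slopes d (suc (suc m))) (S.∣m∣n⇒∣m-n end start)))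
    }
    where
    open IsHeight h
    cancel : ∀ a b → (a ℤ.- b) ℤ.+ b ≡ a
    cancel = solve-∀

  slopes-flat : ∀ d → IsHeight d → (∀ j → j < suc m → d (suc j) ≡ 0ℤ) → SameVertex n m (slopes d) zeroV
  slopes-flat d h flat j j≤m+1 = coord-trans (reduce-coord j (slope d j)) flat-slope
    where
    open IsHeight h
    height-div : ∀ j → j ≤ suc (suc m) → + n S.∣ d j
    height-div zero    _   = start
    height-div (suc j) j≤ with ℕP.m≤n⇒m<n∨m≡n (ℕP.≤-pred j≤)
    ... | inj₁ j<m+1 = subst (+ n S.∣_) (sym (flat j j<m+1)) (S.divides 0ℤ refl)
    ... | inj₂ refl  = end
    interior-slope : ∀ j → j ≤ suc m → ¬ Boundary m j → slope d j ≡ 0ℤ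
    interior-slope zero    _  nb = ⊥-elim (nb (inj₁ refl))
    interior-slope (suc j) j≤ nb with ℕP.m≤n⇒m<n∨m≡n j≤
    ... | inj₁ j+1<m+1 = cong₂ ℤ._-_ (flat (suc j) j+1<m+1) (flat j (ℕP.<-trans (ℕP.n<1+n j) j+1<m+1))
    ... | inj₂ refl    = ⊥-elim (nb (inj₂ refl))
    flat-slope : CoordEq n m j (slope d j) 0ℤ
    flat-slope = coord-from-div
      (subst (+ n S.∣_) (sym (ℤP.+-identityʳ (slope d j)))
             (S.∣m∣n⇒∣m-n (height-div (suc j) (s≤s j≤m+1)) (height-div j (ℕP.m≤n⇒m≤1+n j≤m+1))))
      (interior-slope j j≤m+1)

  walk-resp : ∀ {u u′ w k} → SameVertex n m u u′ → Walk n m u′ w k → Walk n m u w k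
  walk-resp same (here same′) = here (λ j j≤ → coord-trans (same j j≤) (same′ j j≤))
  walk-resp same (step (i , i≤m , s , sign , others , at-i , at-i+1) x-vertex walk) =
    step (i , i≤m , s , sign ,
          (λ j j≤ j≢i j≢i+1 → coord-trans (same j j≤) (others j j≤ j≢i j≢i+1)) ,
          coord-trans (same i (ℕP.m≤n⇒m≤1+n i≤m)) at-i ,
          coord-trans (same (suc i) (s≤s i≤m)) at-i+1)
         x-vertex walk

  -- Lowering d at coordinate k = k′+1 by a unit s (d k ↦ d k - s) is an edge
  -- between the slope sequences, provided no other value of d in 1 … m+1
  -- equals d k + s (which would make a neighbouring slope overshoot).
  module Lowering (d : Tuple) (h : IsHeight d) (k′ : ℕ) (k′≤m : k′ ≤ m) (s : ℤ) (sign : Sign s)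
                  (no-overshoot : ∀ j → 1 ≤ j → j ≤ suc m → d j ≢ d (suc k′) ℤ.+ s) where
    open IsHeight h

    k : ℕ
    k = suc k′

    lowered : ℤ
    lowered = d k ℤ.- s

    d′ : Tuple
    d′ = update d k lowered

    slope-other : ∀ j → j ≢ k′ → j ≢ k → slope d′ j ≡ slope d j
    slope-other j j≢k′ j≢k =
      cong₂ ℤ._-_ (update-other d k lowered (suc j) (j≢k′ ∘ ℕP.suc-injective)) (update-other d k lowered j j≢k)

    slope-left : slope d k′ ≡ slope d′ k′ ℤ.+ s
    slope-left = begin
      d k ℤ.- d k′                 ≡⟨ shift (d k) (d k′) s ⟩
      (d k ℤ.- s) ℤ.- d k′ ℤ.+ s   ≡⟨ cong₂ (λ a b → a ℤ.- b ℤ.+ s) (update-same d k lowered) (update-other d k lowered k′ (ℕP.1+n≢n ∘ sym)) ⟨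
      slope d′ k′ ℤ.+ s            ∎
      where
      open ≡-Reasoning
      shift : ∀ a b s → a ℤ.- b ≡ (a ℤ.- s) ℤ.- b ℤ.+ s
      shift = solve-∀

    slope-right : slope d′ k ≡ slope d k ℤ.+ s
    slope-right = begin
      d′ (suc k) ℤ.- d′ k          ≡⟨ cong₂ ℤ._-_ (update-other d k lowered (suc k) ℕP.1+n≢n) (update-same d k lowered) ⟩
      d (suc k) ℤ.- (d k ℤ.- s)    ≡⟨ shift (d (suc k)) (d k) s ⟩
      slope d k ℤ.+ s              ∎
      where
      open ≡-Reasoning
      shift : ∀ a b s → a ℤ.- (b ℤ.- s) ≡ a ℤ.- b ℤ.+ s
      shift = solve-∀

    height : IsHeight d′
    height = record
      { start     = subst (+ n S.∣_) (sym (update-other d k lowered 0 (λ ()))) start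
      ; end       = subst (+ n S.∣_) (sym (update-other d k lowered (suc (suc m)) (ℕP.<⇒≢ (s≤s (s≤s k′≤m)) ∘ sym))) end
      ; lipschitz = lipschitz′
      }
      where
      left-trit : 1 ≤ k′ → Trit (slope d′ k′)
      left-trit 1≤k′ = subst Trit (sym (≡+⇒≡- slope-left))
        (trit-- (lipschitz k′ 1≤k′ k′≤m) sign (no-overshoot k′ 1≤k′ (ℕP.m≤n⇒m≤1+n k′≤m) ∘ diff≡-⇒≡+ {d k}))
      right-trit : k ≤ m → Trit (slope d′ k)
      right-trit k≤m = subst Trit (sym slope-right)
        (trit-+ (lipschitz k (s≤s z≤n) k≤m) sign (no-overshoot (suc k) (s≤s z≤n) (s≤s k≤m) ∘ diff≡⇒≡+))
      lipschitz′ : ∀ j → 1 ≤ j → j ≤ m → Trit (slope d′ j)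
      lipschitz′ j 1≤j j≤m = by-position (j ℕ.≟ k′) (j ℕ.≟ k)
        where
        by-position : Dec (j ≡ k′) → Dec (j ≡ k) → Trit (slope d′ j)
        by-position (yes refl) _          = left-trit 1≤j
        by-position (no _)     (yes refl) = right-trit j≤m
        by-position (no j≢k′)  (no j≢k)   = subst Trit (sym (slope-other j j≢k′ j≢k)) (lipschitz j 1≤j j≤m)

    edge : Adj n m (slopes d) (slopes d′)
    edge = k′ , k′≤m , s , sign ,
           (λ j _ j≢k′ j≢k → coord-≡ (cong (reduce j) (sym (slope-other j j≢k′ j≢k)))) ,
           via-slopes k′ slope-left ,
           via-slopes k (≡+⇒≡- slope-right)
      where
      via-slopes : ∀ j {t} → slope d j ≡ slope d′ j ℤ.+ t → CoordEq n m j (slopes d j) (slopes d′ j ℤ.+ t)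
      via-slopes j {t} eq =
        coord-trans (reduce-coord j _) (coord-trans (coord-≡ eq) (coord-+ t (coord-sym (reduce-coord j _))))

  weight : Tuple → ℕ
  weight d = sumTo (λ j → ℤ.∣ d (suc j) ∣) (suc m)

  -- Repeatedly lowering a value of maximal modulus reaches the flat height,
  -- one edge per unit of weight.
  descent : ∀ D d → IsHeight d → weight d ≡ D → Walk n m (slopes d) zeroV D
  descent zero    d h weight≡0 =
    here (slopes-flat d h (λ j j<m+1 → ℤP.∣i∣≡0⇒i≡0 (sumTo-≡0 (suc m) (λ j → ℤ.∣ d (suc j) ∣) weight≡0 j j<m+1)))
  descent (suc D) d h weight≡ with argmax (λ j → ℤ.∣ d (suc j) ∣) m
  ... | k′ , k′<m+1 , maximal with d (suc k′) ℤ.≟ 0ℤ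
  -- a maximal modulus 0 would force weight 0
  ...   | yes top≡0 = ⊥-elim (ℕP.n≮0 (begin-strict
          D                                    <⟨ ℕP.n<1+n D ⟩
          suc D                                ≡⟨ weight≡ ⟨
          weight d                             ≤⟨ sumTo-mono (suc m) maximal ⟩
          sumTo (λ _ → ℤ.∣ d (suc k′) ∣) (suc m) ≡⟨ sumTo-const (suc m) _ ⟩
          suc m * ℤ.∣ d (suc k′) ∣              ≡⟨ cong (λ t → suc m * ℤ.∣ t ∣) top≡0 ⟩
          suc m * 0                            ≡⟨ ℕP.*-zeroʳ (suc m) ⟩
          0                                    ∎))
    where open ℕP.≤-Reasoning
  ...   | no top≢0 with step-toward-zero (d (suc k′)) top≢0
  ...     | s , sign , closer , farther =
    step L.edge (slopes-vertex L.d′ L.height) (descent D L.d′ L.height weight′)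
    where
    -- d (suc k′) + s has larger modulus than every value of d
    no-overshoot : ∀ j → 1 ≤ j → j ≤ suc m → d j ≢ d (suc k′) ℤ.+ s
    no-overshoot (suc j) _ (s≤s j≤m) eq =
      ℕP.1+n≰n (ℕP.≤-trans (ℕP.≤-reflexive (trans (sym farther) (cong ℤ.∣_∣ (sym eq)))) (maximal j (s≤s j≤m)))
    module L = Lowering d h k′ (ℕP.≤-pred k′<m+1) s sign no-overshoot
    weight′ : weight L.d′ ≡ D
    weight′ = ℕP.suc-injective (trans
      (sumTo-lower (suc m) (λ j → ℤ.∣ d (suc j) ∣) (λ j → ℤ.∣ L.d′ (suc j) ∣) k′ k′<m+1
         (λ j j≢k′ → cong ℤ.∣_∣ (update-other d (suc k′) L.lowered (suc j) (j≢k′ ∘ ℕP.suc-injective)))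
         (trans (cong (λ t → suc ℤ.∣ t ∣) (update-same d (suc k′) L.lowered)) closer))
      weight≡)

  -- A vertex v is the slope sequence of its prefix sums shifted by any
  -- multiple c of n; hence d(v, 0) ≤ Σ_{k=1}^{m+1} |psum v k - c|.
  distance-via-prefix-sums : ∀ v → IsVertex n m v → ∀ c → + n S.∣ c →
                             DistLe n m v zeroV (weight (λ k → psum v k ℤ.- c))
  distance-via-prefix-sums v V c n∣c = _ , ℕP.≤-refl , walk-resp same (descent _ d height refl)
    where
    open IsVertex V
    d : Tuple
    d k = psum v k ℤ.- c
    slope≡v : ∀ j → slope d j ≡ v j
    slope≡v j = cancel (psum v j) (v j) c
      where
      cancel : ∀ p x c → (p ℤ.+ x ℤ.- c) ℤ.- (p ℤ.- c) ≡ x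
      cancel = solve-∀
    height : IsHeight d
    height = record
      { start     = S.∣m∣n⇒∣m-n (S.divides 0ℤ refl) n∣c
      ; end       = S.∣m∣n⇒∣m-n (S.∣ᵤ⇒∣ {i = psum v (suc (suc m))} sum-zero) n∣c
      ; lipschitz = λ j 1≤j j≤m → subst Trit (sym (slope≡v j)) (middle j 1≤j j≤m)
      }
    same : SameVertex n m v (slopes d)
    same j _ = coord-sym (coord-trans (reduce-coord j (slope d j)) (coord-≡ (slope≡v j)))

psum-lipschitz : ∀ {n m v} → IsVertex n m v → ∀ {i j} → 1 ≤ i → i ℕ.≤′ j → j ≤ suc m →
                 ℤ.∣ psum v j ℤ.- psum v i ∣ ≤ j ∸ i
psum-lipschitz {v = v} V {i} _ ℕ.≤′-refl _ =
  ℕP.≤-reflexive (trans (cong ℤ.∣_∣ (ℤP.+-inverseʳ (psum v i))) (sym (ℕP.n∸n≡0 i)))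
psum-lipschitz {v = v} V {i} {suc j} 1≤i (ℕ.≤′-step i≤′j) j<m+1 = begin
  ℤ.∣ psum v j ℤ.+ v j ℤ.- psum v i ∣            ≡⟨ cong ℤ.∣_∣ (regroup (psum v j) (v j) (psum v i)) ⟩
  ℤ.∣ (psum v j ℤ.- psum v i) ℤ.+ v j ∣          ≤⟨ ℤP.∣i+j∣≤∣i∣+∣j∣ (psum v j ℤ.- psum v i) (v j) ⟩
  ℤ.∣ psum v j ℤ.- psum v i ∣ + ℤ.∣ v j ∣        ≤⟨ ℕP.+-mono-≤ (psum-lipschitz V 1≤i i≤′j (ℕP.<⇒≤ j<m+1))
                                                                (∣trit∣≤1 (IsVertex.middle V j (ℕP.≤-trans 1≤i i≤j) (ℕP.≤-pred j<m+1))) ⟩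
  (j ∸ i) + 1                                    ≡⟨ ℕP.+-comm (j ∸ i) 1 ⟩
  suc (j ∸ i)                                    ≡⟨ ℕP.+-∸-assoc 1 i≤j ⟨
  suc j ∸ i                                      ∎
  where
  open ℕP.≤-Reasoning
  i≤j = ℕP.≤′⇒≤ i≤′j
  regroup : ∀ p x q → p ℤ.+ x ℤ.- q ≡ (p ℤ.- q) ℤ.+ x
  regroup = solve-∀

Above : ℕ → ℤ → Set
Above n x = Σ ℕ λ y → x ≡ + y × 0 < y × y < n

Below : ℕ → ℤ → Set
Below n x = Above n (ℤ.- x)

above-step : ∀ {n x t} → Above n x → Trit t → ¬ (+ n S.∣ (x ℤ.+ t)) → Above n (x ℤ.+ t)
above-step {x = x} (y , refl , 0<y , y<n) (inj₂ (inj₁ refl)) _ = y , ℤP.+-identityʳ x , 0<y , y<n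
above-step {n} (y , refl , 0<y , y<n) (inj₂ (inj₂ refl)) n∤y+1 =
  y + 1 , refl , ℕP.<-≤-trans 0<y (ℕP.m≤m+n y 1) ,
  ℕP.≤∧≢⇒< (subst (_≤ n) (ℕP.+-comm 1 y) y<n) (λ y+1≡n → n∤y+1 (subst (λ z → + n S.∣ + z) (sym y+1≡n) S.∣-refl))
above-step (suc zero    , refl , _ , _  ) (inj₁ refl) n∤0 = ⊥-elim (n∤0 (S.divides 0ℤ refl))
above-step (suc (suc y) , refl , _ , y<n) (inj₁ refl) _   = suc y , refl , s≤s z≤n , ℕP.<-trans (ℕP.n<1+n (suc y)) y<n

below-step : ∀ {n x t} → Below n x → Trit t → ¬ (+ n S.∣ (x ℤ.+ t)) → Below n (x ℤ.+ t)
below-step {n} {x} {t} below trit n∤x+t =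
  subst (Above n) (sym (ℤP.neg-distrib-+ x t))
    (above-step below (trit-neg trit)
      (λ n∣-x-t → n∤x+t (subst (+ n S.∣_) (trans (cong ℤ.-_ (sym (ℤP.neg-distrib-+ x t))) (ℤP.neg-involutive _))
                                          (S.∣m⇒∣-m n∣-x-t))))

near-an-end : ∀ x c e → ℤ.∣ x ∣ ≤ e ⊎ ℤ.∣ x ℤ.- c ∣ ≤ e → ℤ.∣ x ∣ + ℤ.∣ x ℤ.- c ∣ ≤ ℤ.∣ c ∣ + (e + e)
near-an-end x c e (inj₁ near0) = begin
  ℤ.∣ x ∣ + ℤ.∣ x ℤ.- c ∣               ≤⟨ ℕP.+-monoʳ-≤ ℤ.∣ x ∣ (ℤP.∣i-j∣≤∣i∣+∣j∣ x c) ⟩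
  ℤ.∣ x ∣ + (ℤ.∣ x ∣ + ℤ.∣ c ∣)         ≤⟨ ℕP.+-mono-≤ near0 (ℕP.+-monoˡ-≤ ℤ.∣ c ∣ near0) ⟩
  e + (e + ℤ.∣ c ∣)                     ≡⟨ rearrange e ℤ.∣ c ∣ ⟩
  ℤ.∣ c ∣ + (e + e)                     ∎
  where
  open ℕP.≤-Reasoning
  rearrange : ∀ e c → e + (e + c) ≡ c + (e + e)
  rearrange = ℕSolver.solve-∀
near-an-end x c e (inj₂ near-c) = begin
  ℤ.∣ x ∣ + ℤ.∣ x ℤ.- c ∣                   ≡⟨ cong (λ t → ℤ.∣ t ∣ + ℤ.∣ x ℤ.- c ∣) (regroup x c) ⟩
  ℤ.∣ (x ℤ.- c) ℤ.+ c ∣ + ℤ.∣ x ℤ.- c ∣     ≤⟨ ℕP.+-monoˡ-≤ ℤ.∣ x ℤ.- c ∣ (ℤP.∣i+j∣≤∣i∣+∣j∣ (x ℤ.- c) c) ⟩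
  (ℤ.∣ x ℤ.- c ∣ + ℤ.∣ c ∣) + ℤ.∣ x ℤ.- c ∣ ≤⟨ ℕP.+-mono-≤ (ℕP.+-monoˡ-≤ ℤ.∣ c ∣ near-c) near-c ⟩
  (e + ℤ.∣ c ∣) + e                         ≡⟨ rearrange e ℤ.∣ c ∣ ⟩
  ℤ.∣ c ∣ + (e + e)                         ∎
  where
  open ℕP.≤-Reasoning
  regroup : ∀ x c → x ≡ (x ℤ.- c) ℤ.+ c
  regroup = solve-∀
  rearrange : ∀ e c → (e + c) + e ≡ c + (e + e)
  rearrange = ℕSolver.solve-∀

between-ends : ∀ {y n} → y ≤ n → ℤ.∣ + y ∣ + ℤ.∣ + y ℤ.- + n ∣ ≡ n
between-ends {y} {n} y≤n = begin
  y + ℤ.∣ + y ℤ.- + n ∣   ≡⟨ cong (λ t → y + ℤ.∣ t ∣) (trans (ℤP.m-n≡m⊖n y n) (ℤP.⊖-≤ y≤n)) ⟩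
  y + ℤ.∣ ℤ.- + (n ∸ y) ∣ ≡⟨ cong (_+_ y) (ℤP.∣-i∣≡∣i∣ (+ (n ∸ y))) ⟩
  y + (n ∸ y)             ≡⟨ ℕP.m+[n∸m]≡n y≤n ⟩
  n                       ∎
  where open ≡-Reasoning

distLe-weaken : ∀ {n m u w X Y} → DistLe n m u w X → X ≤ Y → DistLe n m u w Y
distLe-weaken (k , k≤X , walk) X≤Y = k , ℕP.≤-trans k≤X X≤Y , walk

double≤sum : ∀ {A B} → A ≤ B → A * 2 ≤ A + B
double≤sum {A} A≤B = ℕP.≤-trans (ℕP.≤-reflexive (trans (ℕP.*-comm A 2) (cong (_+_ A) (ℕP.+-identityʳ A))))
                                (ℕP.+-monoʳ-≤ A A≤B)

-- A window of v: positions P < Q at which the prefix sums are consecutive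
-- multiples of n, with no multiple of n strictly in between.
-- (In the theorem, P = p_l + 1 and Q = p_r + 1.)
record Window (n m : ℕ) (v : Tuple) (P Q : ℕ) : Set where
  field
    P<Q      : P < Q
    P≤m      : P ≤ m
    Q≤m+2    : Q ≤ suc (suc m)
    start    : + n S.∣ psum v P
    rise     : psum v Q ≡ psum v P ℤ.+ + n
    interior : ∀ k → P < k → k < Q → ¬ (+ n S.∣ psum v k)

-- Relative to the
-- start of the window, the prefix sums g k stay strictly between 0 and n
-- inside the window and are 1-Lipschitz outside it; comparing v with the
-- heights g and g - n gives two walks to 0 whose lengths add up to at most
-- n (m+1) + 2 (tri (P-1) + tri (m+1-Q)).
module WindowBound {n m : ℕ} .{{_ : NonZero n}} (1<n : 1 < n) {v : Tuple} (V : IsVertex n m v)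
                   {P Q : ℕ} (W : Window n m v P Q) where
  open IsVertex V
  open Window W
  open Heights n m using (weight; distance-via-prefix-sums)

  a : ℤ
  a = psum v P

  g : ℕ → ℤ
  g k = psum v k ℤ.- a

  g-step : ∀ k → g (suc k) ≡ g k ℤ.+ v k
  g-step k = regroup (psum v k) (v k) a
    where
    regroup : ∀ p x a → p ℤ.+ x ℤ.- a ≡ (p ℤ.- a) ℤ.+ x
    regroup = solve-∀

  g-start : g (suc P) ≡ v P
  g-start = trans (g-step P) (trans (cong (ℤ._+ v P) (ℤP.+-inverseʳ a)) (ℤP.+-identityˡ (v P)))

  g-end : g Q ≡ + n
  g-end = trans (cong (ℤ._- a) rise) (cancel a (+ n))
    where
    cancel : ∀ a b → a ℤ.+ b ℤ.- a ≡ b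
    cancel = solve-∀

  g-interior : ∀ k → P < k → k < Q → ¬ (+ n S.∣ g k)
  g-interior k P<k k<Q n∣gk =
    interior k P<k k<Q (subst (+ n S.∣_) (cancel (psum v k) a) (S.∣m∣n⇒∣m+n n∣gk start))
    where
    cancel : ∀ p a → p ℤ.- a ℤ.+ a ≡ p
    cancel = solve-∀

  middle-index : ∀ {k} → P < k → suc k < Q → 1 ≤ k × k ≤ m
  middle-index P<k k+1<Q = ℕP.≤-trans (s≤s z≤n) P<k , ℕP.≤-pred (ℕP.≤-pred (ℕP.≤-trans k+1<Q Q≤m+2))

  enter : suc P < Q → Above n (g (suc P)) ⊎ Below n (g (suc P))
  enter P+1<Q = map-⊎ (subst (Above n) (sym g-start)) (subst (Below n) (sym g-start)) (by-position P refl)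
    where
    nonzero : ¬ (+ n S.∣ v P)
    nonzero n∣vP = g-interior (suc P) (ℕP.n<1+n P) P+1<Q (subst (+ n S.∣_) (sym g-start) n∣vP)
    -- P = 0 crosses the boundary coordinate 0, otherwise a middle one
    by-position : ∀ p → p ≡ P → Above n (v P) ⊎ Below n (v P)
    by-position zero    refl with v 0 | first-range | nonzero
    ... | + zero   | _               | n∤0 = ⊥-elim (n∤0 (S.divides 0ℤ refl))
    ... | + suc w  | _ , ℤ.+<+ w<n   | _   = inj₁ (suc w , refl , s≤s z≤n , w<n)
    ... | -[1+ _ ] | () , _          | _
    by-position (suc p) refl with middle (suc p) (s≤s z≤n) P≤m
    ... | inj₁ vP≡-1        = inj₂ (1 , cong ℤ.-_ vP≡-1 , s≤s z≤n , 1<n)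
    ... | inj₂ (inj₁ vP≡0)  = ⊥-elim (nonzero (subst (+ n S.∣_) (sym vP≡0) (S.divides 0ℤ refl)))
    ... | inj₂ (inj₂ vP≡1)  = inj₁ (1 , vP≡1 , s≤s z≤n , 1<n)

  stay : ∀ {Side : ℤ → Set} →
         (∀ {x t} → Side x → Trit t → ¬ (+ n S.∣ (x ℤ.+ t)) → Side (x ℤ.+ t)) →
         ∀ k → P < k → suc k < Q → Side (g k) → Side (g (suc k))
  stay {Side} side-step k P<k k+1<Q side =
    subst Side (sym (g-step k))
      (side-step side (middle k (proj₁ (middle-index P<k k+1<Q)) (proj₂ (middle-index P<k k+1<Q)))
                 (g-interior (suc k) (ℕP.<-trans P<k (ℕP.n<1+n k)) k+1<Q ∘ subst (+ n S.∣_) (sym (g-step k))))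

  side : ∀ k → P < k → k < Q → Above n (g k) ⊎ Below n (g k)
  side (suc k) P<k+1 k+1<Q with ℕP.m≤n⇒m<n∨m≡n (ℕP.≤-pred P<k+1)
  ... | inj₂ refl = enter k+1<Q
  ... | inj₁ P<k  = map-⊎ (stay {Above n} above-step k P<k k+1<Q) (stay {Below n} below-step k P<k k+1<Q)
                                 (side k P<k (ℕP.<-trans (ℕP.n<1+n k) k+1<Q))

  below-persists : ∀ {k q} → k ℕ.≤′ q → P < k → q < Q → Below n (g k) → Below n (g q)
  below-persists ℕ.≤′-refl          _   _   below = below
  below-persists (ℕ.≤′-step k≤′q) P<k q+1<Q below =
    stay {Below n} below-step _ (ℕP.<-≤-trans P<k (ℕP.≤′⇒≤ k≤′q)) q+1<Q
         (below-persists k≤′q P<k (ℕP.<-trans (ℕP.n<1+n _) q+1<Q) below)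

  -- g cannot reach n = g Q from below 0 in its last step: that step would
  -- exceed a trit inside and n - 1 at the last coordinate.
  not-below-at-end : ∀ q → P < q → suc q ≡ Q → ¬ Below n (g q)
  not-below-at-end q P<q refl (y , -gq≡y , 0<y , _) = impossible (q ℕ.≟ suc m)
    where
    vq≡n+y : v q ≡ + (n + y)
    vq≡n+y = begin
      v q                         ≡⟨ isolate (g q) (v q) ⟩
      (g q ℤ.+ v q) ℤ.+ ℤ.- g q   ≡⟨ cong₂ ℤ._+_ (trans (sym (g-step q)) g-end) -gq≡y ⟩
      + n ℤ.+ + y                 ∎
      where
      open ≡-Reasoning
      isolate : ∀ x t → t ≡ (x ℤ.+ t) ℤ.+ ℤ.- x
      isolate = solve-∀
    impossible : Dec (q ≡ suc m) → ⊥
    impossible (yes refl) =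
      ℕP.<-asym (ℤP.drop‿+<+ (subst (ℤ._< + n) vq≡n+y (proj₂ last-range))) (ℕP.m<m+n n 0<y)
    impossible (no q≢m+1) =
      large-not-trit (ℕP.<-≤-trans 1<n (ℕP.m≤m+n n y))
        (subst Trit vq≡n+y (middle q (ℕP.≤-trans (s≤s z≤n) P<q)
                                     (ℕP.≤-pred (ℕP.≤∧≢⇒< (ℕP.≤-pred Q≤m+2) q≢m+1))))

  inside : ∀ k → P < k → k < Q → Above n (g k)
  inside k P<k k<Q with side k P<k k<Q
  ... | inj₁ above = above
  ... | inj₂ below =
    ⊥-elim (not-below-at-end q (ℕP.<-≤-trans P<k k≤q) q+1≡Q
                             (below-persists (ℕP.≤⇒≤′ k≤q) P<k (subst (q <_) q+1≡Q (ℕP.n<1+n q)) below))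
    where
    q : ℕ
    q = ℕ.pred Q
    k≤q : k ≤ q
    k≤q = ℕP.<⇒≤pred k<Q
    q+1≡Q : suc q ≡ Q
    q+1≡Q = ℕP.suc-pred Q {{ℕ.>-nonZero (ℕP.<-≤-trans (s≤s z≤n) k<Q)}}

  outside : ℕ → ℕ
  outside k = (P ∸ k) + (k ∸ Q)

  -- Lipschitz to the left of P and to the right of Q, between 0 and n inside.
  pointwise : ∀ k → 1 ≤ k → k ≤ suc m → ℤ.∣ g k ∣ + ℤ.∣ g k ℤ.- + n ∣ ≤ n + (outside k + outside k)
  pointwise k 1≤k k≤m+1 with k ℕ.≤? P | Q ℕ.≤? k
  ... | yes k≤P | _ = near-an-end (g k) (+ n) (outside k) (inj₁ (begin
    ℤ.∣ psum v k ℤ.- a ∣ ≡⟨ ℤP.∣i-j∣≡∣j-i∣ (psum v k) a ⟩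
    ℤ.∣ a ℤ.- psum v k ∣ ≤⟨ psum-lipschitz V 1≤k (ℕP.≤⇒≤′ k≤P) (ℕP.m≤n⇒m≤1+n P≤m) ⟩
    P ∸ k               ≤⟨ ℕP.m≤m+n (P ∸ k) (k ∸ Q) ⟩
    outside k           ∎))
    where open ℕP.≤-Reasoning
  ... | no _    | yes Q≤k = near-an-end (g k) (+ n) (outside k) (inj₂ (begin
    ℤ.∣ psum v k ℤ.- a ℤ.- + n ∣      ≡⟨ cong ℤ.∣_∣ (regroup (psum v k) a (+ n)) ⟩
    ℤ.∣ psum v k ℤ.- (a ℤ.+ + n) ∣    ≡⟨ cong (λ t → ℤ.∣ psum v k ℤ.- t ∣) rise ⟨
    ℤ.∣ psum v k ℤ.- psum v Q ∣       ≤⟨ psum-lipschitz V (ℕP.≤-trans (s≤s z≤n) P<Q) (ℕP.≤⇒≤′ Q≤k) k≤m+1 ⟩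
    k ∸ Q                             ≤⟨ ℕP.m≤n+m (k ∸ Q) (P ∸ k) ⟩
    outside k                         ∎))
    where
    open ℕP.≤-Reasoning
    regroup : ∀ p a c → p ℤ.- a ℤ.- c ≡ p ℤ.- (a ℤ.+ c)
    regroup = solve-∀
  ... | no k≰P  | no Q≰k with inside k (ℕP.≰⇒> k≰P) (ℕP.≰⇒> Q≰k)
  ...   | y , gk≡y , _ , y<n = begin
    ℤ.∣ g k ∣ + ℤ.∣ g k ℤ.- + n ∣  ≡⟨ cong (λ t → ℤ.∣ t ∣ + ℤ.∣ t ℤ.- + n ∣) gk≡y ⟩
    ℤ.∣ + y ∣ + ℤ.∣ + y ℤ.- + n ∣  ≡⟨ between-ends (ℕP.<⇒≤ y<n) ⟩
    n                             ≤⟨ ℕP.m≤m+n n _ ⟩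
    n + (outside k + outside k)   ∎
    where open ℕP.≤-Reasoning

  tails : ℕ
  tails = tri (P ∸ 1) + tri (suc m ∸ Q)

  outside-sum : sumTo (outside ∘ suc) (suc m) ≤ tails
  outside-sum = begin
    sumTo (outside ∘ suc) (suc m)                                          ≡⟨ sumTo-+ (suc m) (λ j → P ∸ suc j) (λ j → suc j ∸ Q) ⟩
    sumTo (λ j → P ∸ suc j) (suc m) + sumTo (λ j → suc j ∸ Q) (suc m)      ≤⟨ ℕP.+-mono-≤ (sum-left-tail (suc m) P)
                                                                                            (ℕP.≤-reflexive (sum-right-tail (suc m) Q)) ⟩
    tails                                                                  ∎
    where open ℕP.≤-Reasoning

  -- the lengths of the walks through the heights g and g - n
  weight₀ weightₙ : ℕ
  weight₀ = weight g
  weightₙ = weight (λ k → g k ℤ.- + n)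

  weights-sum : weight₀ + weightₙ ≤ n * (m + 1) + tails * 2
  weights-sum = begin
    weight₀ + weightₙ                                         ≡⟨ sumTo-+ (suc m) (λ j → ℤ.∣ g (suc j) ∣) (λ j → ℤ.∣ g (suc j) ℤ.- + n ∣) ⟨
    sumTo (λ j → ℤ.∣ g (suc j) ∣ + ℤ.∣ g (suc j) ℤ.- + n ∣) (suc m)
      ≤⟨ sumTo-mono (suc m) (λ j j<m+1 → pointwise (suc j) (s≤s z≤n) j<m+1) ⟩
    sumTo (λ j → n + (outside (suc j) + outside (suc j))) (suc m)
      ≡⟨ trans (sumTo-+ (suc m) (λ _ → n) (λ j → outside (suc j) + outside (suc j)))
               (cong₂ _+_ (sumTo-const (suc m) n) (sumTo-+ (suc m) (outside ∘ suc) (outside ∘ suc))) ⟩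
    suc m * n + (sumTo (outside ∘ suc) (suc m) + sumTo (outside ∘ suc) (suc m))
      ≤⟨ ℕP.+-monoʳ-≤ (suc m * n) (ℕP.+-mono-≤ outside-sum outside-sum) ⟩
    suc m * n + (tails + tails)                                ≡⟨ rearrange m n tails ⟩
    n * (m + 1) + tails * 2                                    ∎
    where
    open ℕP.≤-Reasoning
    rearrange : ∀ m n t → suc m * n + (t + t) ≡ n * (m + 1) + t * 2
    rearrange = ℕSolver.solve-∀

  -- The shorter of the two walks has length at most half the total.
  distance-bound : DistLe n m v zeroV (tails + n * (m + 1) / 2)
  distance-bound with ℕP.≤-total weight₀ weightₙ
  ... | inj₁ w₀≤wₙ = distLe-weaken (distance-via-prefix-sums v V a start)
                                   (halve weight₀ tails _ (ℕP.≤-trans (double≤sum w₀≤wₙ) weights-sum))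
  ... | inj₂ wₙ≤w₀ = distLe-weaken (subst (DistLe n m v zeroV) shifted
                                          (distance-via-prefix-sums v V (a ℤ.+ + n) (S.∣m∣n⇒∣m+n start S.∣-refl)))
                                   (halve weightₙ tails _
                                     (ℕP.≤-trans (subst (weightₙ * 2 ≤_) (ℕP.+-comm weightₙ weight₀) (double≤sum wₙ≤w₀))
                                                 weights-sum))
    where
    shifted : weight (λ k → psum v k ℤ.- (a ℤ.+ + n)) ≡ weightₙ
    shifted = sumTo-cong (suc m) (λ j _ → cong ℤ.∣_∣ (regroup (psum v (suc j)) a (+ n)))
      where
      regroup : ∀ p a c → p ℤ.- (a ℤ.+ c) ≡ p ℤ.- a ℤ.- c
      regroup = solve-∀

sumBelow-empty : ∀ u a b → b ≤ a → sumBelow u a b ≡ 0ℤ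
sumBelow-empty u a zero    _   = refl
sumBelow-empty u a (suc b) b<a with a ℕ.≤ᵇ b in a≤ᵇb
... | true  = ⊥-elim (ℕP.<⇒≱ b<a (ℕP.≤ᵇ⇒≤ a b (subst T (sym a≤ᵇb) tt)))
... | false = trans (ℤP.+-identityʳ _) (sumBelow-empty u a b (ℕP.<⇒≤ b<a))

sumBelow-split : ∀ u {a b} → a ℕ.≤′ b → sumBelow u a b ℤ.+ psum u a ≡ psum u b
sumBelow-split u {a} ℕ.≤′-refl = trans (cong (ℤ._+ psum u a) (sumBelow-empty u a a ℕP.≤-refl)) (ℤP.+-identityˡ _)
sumBelow-split u {a} {suc b} (ℕ.≤′-step a≤′b) with a ℕ.≤ᵇ b | ℕP.≤⇒≤ᵇ (ℕP.≤′⇒≤ a≤′b)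
... | true | _ = trans (swap (sumBelow u a b) (u b) (psum u a)) (cong (ℤ._+ u b) (sumBelow-split u a≤′b))
  where
  swap : ∀ x y z → x ℤ.+ y ℤ.+ z ≡ x ℤ.+ z ℤ.+ y
  swap = solve-∀

pivot-at : ∀ {n m v k} → k ≤ suc m → + n S.∣ psum v (suc k) → IsPivot n m v (+ k)
pivot-at {n} {v = v} {k} k≤m+1 n∣ =
  ℤ.-≤+ , ℤ.+≤+ k≤m+1 , S.∣⇒∣ᵤ (subst (λ i → + n S.∣ psum v i) (ℕP.+-comm 1 k) n∣)

twice : ∀ k → + 2 ℤ.* + k ≡ + (2 * k)
twice k = sym (ℤP.pos-* 2 k)

-- A prefix sum divisible by n strictly between P = p_l + 1 and Q = p_r + 1
-- would give a pivot contradicting the maximality of p_l or the minimality of p_r.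
no-pivot-between : ∀ {n m v P Q} → Q ≤ suc (suc m) →
  (∀ k → k ≤ suc m → + n S.∣ psum v (suc k) → 2 * k < m → suc k ≤ P) →
  (∀ k → k ≤ suc m → + n S.∣ psum v (suc k) → m ≤ 2 * k → Q ≤ suc k) →
  ∀ k → P < k → k < Q → ¬ (+ n S.∣ psum v k)
no-pivot-between {m = m} Q≤m+2 left-max right-min (suc k) P<k+1 k+1<Q n∣ = by-side (2 * k ℕ.<? m)
  where
  k≤m+1 : k ≤ suc m
  k≤m+1 = ℕP.<⇒≤ (ℕP.≤-pred (ℕP.<-≤-trans k+1<Q Q≤m+2))
  by-side : Dec (2 * k < m) → ⊥
  by-side (yes 2k<m) = ℕP.<⇒≱ P<k+1 (left-max k k≤m+1 n∣ 2k<m)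
  by-side (no  2k≮m) = ℕP.<⇒≱ k+1<Q (right-min k k≤m+1 n∣ (ℕP.≮⇒≥ 2k≮m))

window-of-pivots : ∀ {n m v} P r → P < suc r → P ≤ m → r ≤ suc m → + n S.∣ psum v P → sumFromTo v P r ≡ + n →
  (∀ k → k ≤ suc m → + n S.∣ psum v (suc k) → 2 * k < m → suc k ≤ P) →
  (∀ k → k ≤ suc m → + n S.∣ psum v (suc k) → m ≤ 2 * k → r ≤ k) →
  Window n m v P (suc r)
window-of-pivots {n} {v = v} P r P≤r P≤m r≤m+1 n∣ centre left-max right-min = record
  { P<Q      = P≤r
  ; P≤m      = P≤m
  ; Q≤m+2    = s≤s r≤m+1
  ; start    = n∣
  ; rise     = trans (sym (sumBelow-split v (ℕP.≤⇒≤′ (ℕP.<⇒≤ P≤r))))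
                     (trans (cong (ℤ._+ psum v P) centre) (ℤP.+-comm (+ n) (psum v P)))
  ; interior = no-pivot-between (s≤s r≤m+1) left-max (λ k k≤ n∣ m≤2k → s≤s (right-min k k≤ n∣ m≤2k))
  }

triZ-diff : ∀ m r → triZ (+ m ℤ.- + r) ≡ tri (m ∸ r)
triZ-diff m r with r ℕ.≤? m
... | yes r≤m = cong triZ (trans (ℤP.m-n≡m⊖n m r) (ℤP.⊖-≥ r≤m))
... | no  r≰m = trans (cong triZ (trans (ℤP.m-n≡m⊖n m r) (ℤP.⊖-< m<r)))
                      (trans (negative (r ∸ m) (ℕP.m>n⇒m∸n≢0 m<r)) (cong tri (sym (ℕP.m≤n⇒m∸n≡0 (ℕP.<⇒≤ m<r)))))
  where
  m<r = ℕP.≰⇒> r≰m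
  negative : ∀ k → k ≢ 0 → triZ (ℤ.- + k) ≡ 0
  negative zero    k≢0 = ⊥-elim (k≢0 refl)
  negative (suc k) _   = refl

record CentralWindow (n m : ℕ) (v : Tuple) (pl pr : ℤ) : Set where
  field
    window     : Window n m v ℤ.∣ pl ℤ.+ 1ℤ ∣ (suc ℤ.∣ pr ∣)
    left-tail  : triZ pl ≡ tri (ℤ.∣ pl ℤ.+ 1ℤ ∣ ∸ 1)
    right-tail : triZ (+ m ℤ.- pr) ≡ tri (suc m ∸ suc ℤ.∣ pr ∣)

left-maximal : ∀ {n m v pl} → IsPl n m v pl →
  ∀ k → k ≤ suc m → + n S.∣ psum v (suc k) → 2 * k < m → + k ℤ.≤ pl
left-maximal (_ , maximal) k k≤m+1 n∣ 2k<m =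
  maximal (+ k) (pivot-at k≤m+1 n∣) (subst (ℤ._< + _) (sym (twice k)) (ℤ.+<+ 2k<m))

right-minimal : ∀ {n m v pr} → IsPr n m v pr →
  ∀ k → k ≤ suc m → + n S.∣ psum v (suc k) → m ≤ 2 * k → pr ℤ.≤ + k
right-minimal (_ , minimal) k k≤m+1 n∣ m≤2k =
  minimal (+ k) (pivot-at k≤m+1 n∣) (subst (+ _ ℤ.≤_) (sym (twice k)) (ℤ.+≤+ m≤2k))

central-window : ∀ {n m v pl pr} → IsPl n m v pl → IsPr n m v pr →
                 sumFromTo v ℤ.∣ pl ℤ.+ 1ℤ ∣ ℤ.∣ pr ∣ ≡ + n → CentralWindow n m v pl pr
central-window {pl = -[1+ suc _ ]} (((ℤ.-≤- () , _) , _) , _) _ _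
central-window {pr = -[1+ _ ]} _ ((_ , m≤2pr) , _) _ = case m≤2pr of λ ()
central-window {m = m} {pl = -[1+ zero ]} {pr = + r} isPl@(((_ , _ , n∣) , _) , _) isPr@(((_ , r≤m+1 , _) , _) , _) centre = record
  { window     = window-of-pivots 0 r (s≤s z≤n) z≤n (ℤP.drop‿+≤+ r≤m+1) (S.∣ᵤ⇒∣ n∣) centre
                   (λ k k≤ n∣ 2k<m → case left-maximal isPl k k≤ n∣ 2k<m of λ ())
                   (λ k k≤ n∣ m≤2k → ℤP.drop‿+≤+ (right-minimal isPr k k≤ n∣ m≤2k))
  ; left-tail  = refl
  ; right-tail = triZ-diff m r
  }
central-window {m = m} {pl = + p} {pr = + r} isPl@(((_ , _ , n∣) , 2p<m) , _) isPr@(((_ , r≤m+1 , _) , m≤2r) , _) centre = record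
  { window     = window-of-pivots (p + 1) r (s≤s p+1≤r) p+1≤m (ℤP.drop‿+≤+ r≤m+1) (S.∣ᵤ⇒∣ n∣) centre
                   (λ k k≤ n∣ 2k<m → subst (suc k ≤_) (ℕP.+-comm 1 p) (s≤s (ℤP.drop‿+≤+ (left-maximal isPl k k≤ n∣ 2k<m))))
                   (λ k k≤ n∣ m≤2k → ℤP.drop‿+≤+ (right-minimal isPr k k≤ n∣ m≤2k))
  ; left-tail  = cong tri (sym (ℕP.m+n∸n≡m p 1))
  ; right-tail = triZ-diff m r
  }
  where
  2p<m′ : 2 * p < m
  2p<m′ = ℤP.drop‿+<+ (subst (ℤ._< + m) (twice p) 2p<m)
  p+1≤r : p + 1 ≤ r
  p+1≤r = subst (_≤ r) (ℕP.+-comm 1 p)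
                (ℕP.*-cancelˡ-< 2 p r (ℕP.<-≤-trans 2p<m′ (ℤP.drop‿+≤+ (subst (+ m ℤ.≤_) (twice r) m≤2r))))
  p+1≤m : p + 1 ≤ m
  p+1≤m = ℕP.≤-trans (ℕP.≤-reflexive (ℕP.+-comm p 1)) (ℕP.≤-trans (s≤s (ℕP.m≤m+n p (p + 0))) 2p<m′)

lemma5p25 : (n m : ℕ) → 1 < n → n ≤ m → (v : Tuple) → IsVertex n m v →
    (pl pr : ℤ) → IsPl n m v pl → IsPr n m v pr →
    sumFromTo v ℤ.∣ pl ℤ.+ ℤ.1ℤ ∣ ℤ.∣ pr ∣ ≡ + n →
    DistLe n m v zeroV (triZ pl + triZ (+ m ℤ.- pr) + (n * (m + 1)) / 2)
lemma5p25 n m 1<n _ v V pl pr isPl isPr centre =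
  subst (λ t → DistLe n m v zeroV (t + n * (m + 1) / 2))
        (sym (cong₂ _+_ left-tail right-tail))
        (WindowBound.distance-bound 1<n V window)
  where
  instance
    n≢0 : NonZero n
    n≢0 = ℕ.>-nonZero (ℕP.<⇒≤ 1<n)
  open CentralWindow (central-window isPl isPr centre)
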